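{- The Specker–Blatter theorem fails in the presence of a hard-wired linear order: there is a first-order sentence $\phi$ in the vocabulary consisting of two binary relation symbols $R$ and $<$ such that, if $S(n)$ denotes the number of relations $R\subseteq[n]^2$ with $([n],R,<_{\mathrm{nat}})\models\phi$, where $<_{\mathrm{nat}}$ is the natural order on $[n]$ (so $<$ is hard-wired), then $S(n)$ is not MC-finite.
   Context: A sequence of integers $s(n)$ is MC-finite if for every $m\in\mathbb{N}^+$ the sequence $s(n)\bmod m$ is ultimately periodic (equivalently, satisfies modulo $m$ a linear recurrence with constant integer coefficients depending on $m$, for all sufficiently large $n$). The Specker–Blatter theorem asserts that for vocabularies of unary and binary relation symbols (without hard-wired relations) the number of labeled structures on $[n]$ satisfying a fixed sentence of monadic second order logic with modular counting is MC-finite. -}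

module Defs where

open import Data.Nat using (ℕ; zero; suc; _+_; _*_; _≤_; _%_; NonZero; _<ᵇ_)
open import Data.Fin using (Fin; toℕ) renaming (zero to fz; suc to fs)
open import Data.Bool using (Bool; true; false; _∧_; _∨_; not; if_then_else_)
open import Data.List using (List; []; _∷_; concatMap; map)
open import Data.Product using (Σ; ∃; _×_; _,_)
open import Relation.Binary.PropositionalEquality using (_≡_)
open import Relation.Nullary using (does)
import Data.Fin as Fin

-- First-order formulas over the vocabulary {R, <} (both binary),
-- with equality; variables are de Bruijn indices, k = number of free variables.
data Formula : ℕ → Set where
  R⟨_,_⟩ : ∀ {k} → Fin k → Fin k → Formula k
  _<'_   : ∀ {k} → Fin k → Fin k → Formula k
  _≐_    : ∀ {k} → Fin k → Fin k → Formula k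
  ¬'_    : ∀ {k} → Formula k → Formula k
  _∧'_   : ∀ {k} → Formula k → Formula k → Formula k
  ∃'_    : ∀ {k} → Formula (suc k) → Formula k

Sentence : Set
Sentence = Formula 0

anyFin : (n : ℕ) → (Fin n → Bool) → Bool
anyFin zero    f = false
anyFin (suc n) f = f fz ∨ anyFin n (λ i → f (fs i))

extend : ∀ {n k} → Fin n → (Fin k → Fin n) → Fin (suc k) → Fin n
extend a ρ fz     = a
extend a ρ (fs i) = ρ i

sat : (n : ℕ) → (Fin n → Fin n → Bool) → ∀ {k} → Formula k → (Fin k → Fin n) → Bool
sat n R R⟨ x , y ⟩ ρ = R (ρ x) (ρ y)
sat n R (x <' y)   ρ = toℕ (ρ x) <ᵇ toℕ (ρ y)
sat n R (x ≐ y)    ρ = does (ρ x Fin.≟ ρ y)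
sat n R (¬' φ)     ρ = not (sat n R φ ρ)
sat n R (φ ∧' ψ)   ρ = sat n R φ ρ ∧ sat n R ψ ρ
sat n R (∃' φ)     ρ = anyFin n (λ a → sat n R φ (extend a ρ))

noVars : ∀ {n} → Fin 0 → Fin n
noVars ()

_⊨_ : ∀ {n} → (Fin n → Fin n → Bool) → Sentence → Bool
_⊨_ {n} R φ = sat n R φ noVars

allFuns : ∀ {A : Set} → List A → (k : ℕ) → List (Fin k → A)
allFuns xs zero    = (λ ()) ∷ []
allFuns xs (suc k) =
  concatMap (λ a → map (λ f → λ { fz → a ; (fs i) → f i }) (allFuns xs k)) xs

-- All binary relations R ⊆ [n]², as characteristic functions (each exactly once).
allRelations : (n : ℕ) → List (Fin n → Fin n → Bool)
allRelations n = allFuns (allFuns (true ∷ false ∷ []) n) n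

count : ∀ {A : Set} → (A → Bool) → List A → ℕ
count p []       = 0
count p (x ∷ xs) = if p x then suc (count p xs) else count p xs

S : Sentence → ℕ → ℕ
S φ n = count (λ R → R ⊨ φ) (allRelations n)

UltPeriodicMod : (ℕ → ℕ) → (m : ℕ) → .{{NonZero m}} → Set
UltPeriodicMod s m = Σ ℕ λ N → Σ ℕ λ p → (1 ≤ p) × (∀ n → N ≤ n → s (n + p) % m ≡ s n % m)

MCFinite : (ℕ → ℕ) → Set
MCFinite s = (m : ℕ) → .{{_ : NonZero m}} → UltPeriodicMod s m

-- Let row x of R be the initial segment [0, c(x)), where c(0) = 0 and c(x+1) is
-- c(x) - 1, or x + 1 when c(x) = 0.  With the order hard-wired, a first-order
-- sentence can say that row 0 is empty, that each row arises from the previous one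
-- by this rule, and that the last row is empty.  On [m+1] it therefore has exactly
-- one model when c(m) = 0 and none otherwise.  The zeros of c are unbounded and a
-- zero w is followed by w + 1 positive values, so for every p ≥ 1 there are
-- arbitrarily large n with S(n) = 1 and S(n + p) = 0: S is not ultimately periodic
-- modulo 2.
module Submission where

open import Defs
open import Data.Product using (Σ)
open import Relation.Nullary using (¬_)

open import Data.Bool using (Bool; true; false; T; not; _∧_; if_then_else_)
open import Data.Bool.Properties using () renaming (_≟_ to _≟ᵇ_)
open import Data.Empty using (⊥-elim)
open import Data.Fin using (Fin; toℕ; fromℕ; fromℕ<; #_) renaming (zero to fz; suc to fs)
open import Data.Fin.Properties using (toℕ<n; toℕ-fromℕ; toℕ-fromℕ<; ⊎⇔∃; ∀-cons-⇔)
open import Data.List using (List; []; _∷_; _++_; map; concatMap)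
open import Data.Nat using (ℕ; zero; suc; _+_; _≤_; _<_; _<ᵇ_; _%_; z≤n; s≤s; s≤s⁻¹; z<s; s<s)
open import Data.Nat.Properties
open import Data.Product using (∃; _×_; _,_; proj₁; proj₂)
open import Data.Sum using (_⊎_; inj₁; inj₂; [_,_])
open import Data.Unit using (tt)
open import Function using (_∘_; _⇔_; mk⇔; Equivalence)
open import Function.Properties.Equivalence using () renaming (sym to ⇔-sym; trans to ⇔-trans)
open import Relation.Binary.PropositionalEquality
  using (_≡_; _≢_; refl; sym; trans; cong; subst; subst₂)
open import Relation.Nullary.Decidable using (does; proof; yes; no)
open import Relation.Nullary.Reflects

open Equivalence using (to; from)

private
  variable
    A B : Set
    a b : Bool

-- Reflection of propositions by booleans

map-reflects : A ⇔ B → Reflects A b → Reflects B b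
map-reflects A⇔B (ofʸ x)  = ofʸ (to A⇔B x)
map-reflects A⇔B (ofⁿ ¬x) = ofⁿ (¬x ∘ from A⇔B)

reflects-false : Reflects A b → ¬ A → b ≡ false
reflects-false r ¬x = det r (ofⁿ ¬x)

reflects-stable : Reflects A b → ¬ ¬ A → A
reflects-stable (ofʸ x)  _   = x
reflects-stable (ofⁿ ¬x) ¬¬x = ⊥-elim (¬¬x ¬x)

reflects-T⇔ : Reflects A b → T b ⇔ A
reflects-T⇔ (ofʸ x)  = mk⇔ (λ _ → x) (λ _ → tt)
reflects-T⇔ (ofⁿ ¬x) = mk⇔ (λ ()) ¬x

≡⇔T⇔ : Reflects A b → (a ≡ b) ⇔ (T a ⇔ A)
≡⇔T⇔ r = mk⇔ (λ { refl → reflects-T⇔ r })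
              (λ T⇔A → sym (T-reflects-elim (map-reflects (⇔-sym T⇔A) r)))

⇒-reflects : Reflects A a → Reflects B b → Reflects (A → B) (not (a ∧ not b))
⇒-reflects (ofʸ x)  (ofʸ y)  = ofʸ (λ _ → y)
⇒-reflects (ofʸ x)  (ofⁿ ¬y) = ofⁿ (λ f → ¬y (f x))
⇒-reflects (ofⁿ ¬x) _        = ofʸ (⊥-elim ∘ ¬x)

∨-reflects : Reflects A a → Reflects B b → Reflects (A ⊎ B) (not (not a ∧ not b))
∨-reflects (ofʸ x)  _        = ofʸ (inj₁ x)
∨-reflects (ofⁿ ¬x) (ofʸ y)  = ofʸ (inj₂ y)
∨-reflects (ofⁿ ¬x) (ofⁿ ¬y) = ofⁿ [ ¬x , ¬y ]

⇔-reflects : Reflects A a → Reflects B b →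
             Reflects (A ⇔ B) (not (a ∧ not b) ∧ not (b ∧ not a))
⇔-reflects r s = map-reflects (mk⇔ (λ (f , g) → mk⇔ f g) (λ e → to e , from e))
                              (⇒-reflects r s ×-reflects ⇒-reflects s r)

anyFin-reflects : ∀ n {P : Fin n → Set} {f : Fin n → Bool} →
                  (∀ i → Reflects (P i) (f i)) → Reflects (∃ P) (anyFin n f)
anyFin-reflects zero    r = ofⁿ λ ()
anyFin-reflects (suc n) r = map-reflects ⊎⇔∃ (r fz ⊎-reflects anyFin-reflects n (r ∘ fs))

allFin : (n : ℕ) → (Fin n → Bool) → Bool
allFin n f = not (anyFin n (not ∘ f))

allFin-reflects : ∀ n {P : Fin n → Set} {f : Fin n → Bool} →
                  (∀ i → Reflects (P i) (f i)) → Reflects (∀ i → P i) (allFin n f)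
allFin-reflects n r =
  map-reflects (mk⇔ (λ ∄¬P i → reflects-stable (r i) (λ ¬Pi → ∄¬P (i , ¬Pi)))
                    (λ ∀P (i , ¬Pi) → ¬Pi (∀P i)))
               (¬-reflects (anyFin-reflects n (¬-reflects ∘ r)))

-- Counting

count-none : ∀ {p : A → Bool} (xs : List A) → (∀ x → p x ≡ false) → count p xs ≡ 0
count-none []       _ = refl
count-none (x ∷ xs) none rewrite none x = count-none xs none

count-singleton : ∀ {p : A → Bool} {x} → p x ≡ true → count p (x ∷ []) ≡ 1
count-singleton px rewrite px = refl

count-++ : ∀ (p : A → Bool) xs ys → count p (xs ++ ys) ≡ count p xs + count p ys
count-++ p []       ys = refl
count-++ p (x ∷ xs) ys with p x
... | true  = cong suc (count-++ p xs ys)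
... | false = count-++ p xs ys

count-map : ∀ (p : B → Bool) (g : A → B) xs → count p (map g xs) ≡ count (p ∘ g) xs
count-map p g []       = refl
count-map p g (x ∷ xs) with p (g x)
... | true  = cong suc (count-map p g xs)
... | false = count-map p g xs

count-concatMap : ∀ {p : B → Bool} {g : A → List B} (q : A → Bool) xs →
                  (∀ x → count p (g x) ≡ (if q x then 1 else 0)) →
                  count p (concatMap g xs) ≡ count q xs
count-concatMap q []       _    = refl
count-concatMap {p = p} {g} q (x ∷ xs) each =
  trans (count-++ p (g x) (concatMap g xs)) (add-head (q x) (each x) (count-concatMap q xs each))
  where
  add-head : ∀ c {l m n} → l ≡ (if c then 1 else 0) → m ≡ n → l + m ≡ (if c then suc n else n)
  add-head true  refl refl = refl
  add-head false refl refl = refl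

-- A function Fin k → A is chosen coordinatewise, so if each coordinate has exactly
-- one admissible value in xs, exactly one function in allFuns xs k is admissible.
count-allFuns : {A : Set} (xs : List A) (k : ℕ) {P : Fin k → A → Set} (q : Fin k → A → Bool) →
                (∀ i x → Reflects (P i x) (q i x)) → (∀ i → count (q i) xs ≡ 1) →
                {p : (Fin k → A) → Bool} → (∀ f → Reflects (∀ i → P i (f i)) (p f)) →
                count p (allFuns xs k) ≡ 1
count-allFuns xs zero    q q-reflects q-once {p} p-reflects =
  count-singleton {p = p} (det (p-reflects _) (ofʸ λ ()))
count-allFuns {A} xs (suc k) {P} q q-reflects q-once {p} p-reflects =
  trans (count-concatMap (q fz) xs
          (λ x → trans (count-map p _ (allFuns xs k))
                       (count-with-head x (λ f → map-reflects (⇔-sym ∀-cons-⇔) (p-reflects _)))))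
        (q-once fz)
  where
  count-with-head : ∀ x {p′ : (Fin k → A) → Bool} →
                    (∀ f → Reflects (P fz x × (∀ i → P (fs i) (f i))) (p′ f)) →
                    count p′ (allFuns xs k) ≡ (if q fz x then 1 else 0)
  count-with-head x r with q fz x | q-reflects fz x
  ... | true  | ofʸ Px  =
    count-allFuns xs k (q ∘ fs) (q-reflects ∘ fs) (q-once ∘ fs)
                  (λ f → map-reflects (mk⇔ proj₂ (Px ,_)) (r f))
  ... | false | ofⁿ ¬Px = count-none (allFuns xs k) (λ f → reflects-false (r f) (¬Px ∘ proj₁))

count-≟ᵇ : ∀ c → count (λ b → does (b ≟ᵇ c)) (true ∷ false ∷ []) ≡ 1
count-≟ᵇ true  = refl
count-≟ᵇ false = refl

count-pointwiseEqual : ∀ n (R₀ : Fin n → Fin n → Bool) {p : (Fin n → Fin n → Bool) → Bool} →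
                       (∀ R → Reflects (∀ x y → R x y ≡ R₀ x y) (p R)) →
                       count p (allRelations n) ≡ 1
count-pointwiseEqual n R₀ =
  count-allFuns (allFuns (true ∷ false ∷ []) n) n rowIs rowIs-reflects
    (λ x → count-allFuns (true ∷ false ∷ []) n (λ y b → does (b ≟ᵇ R₀ x y))
                         (λ y b → proof (b ≟ᵇ R₀ x y)) (λ y → count-≟ᵇ (R₀ x y))
                         (rowIs-reflects x))
  where
  rowIs : Fin n → (Fin n → Bool) → Bool
  rowIs x h = allFin n (λ y → does (h y ≟ᵇ R₀ x y))
  rowIs-reflects : ∀ x h → Reflects (∀ y → h y ≡ R₀ x y) (rowIs x h)
  rowIs-reflects x h = allFin-reflects n (λ y → proof (h y ≟ᵇ R₀ x y))

nothingBelow⇔zero : ∀ {n : ℕ} (x : Fin n) → (¬ ∃ λ (w : Fin n) → toℕ w < toℕ x) ⇔ (toℕ x ≡ 0)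
nothingBelow⇔zero fz     = mk⇔ (λ _ → refl) (λ _ (w , w<0) → n≮0 w<0)
nothingBelow⇔zero (fs x) = mk⇔ (λ ∄ → ⊥-elim (∄ (fz , z<s))) (λ ())

nothingAbove⇔last : ∀ {n} (x : Fin n) → (¬ ∃ λ (w : Fin n) → toℕ x < toℕ w) ⇔ (suc (toℕ x) ≡ n)
nothingAbove⇔last {n} x = mk⇔ last (λ x+1≡n (w , x<w) → <-irrefl refl
                                      (<-≤-trans (toℕ<n w) (subst (_≤ toℕ w) x+1≡n x<w)))
  where
  last : (¬ ∃ λ (w : Fin n) → toℕ x < toℕ w) → suc (toℕ x) ≡ n
  last ∄ = ≤-antisym (toℕ<n x) (≮⇒≥ λ x+1<n →
    ∄ (fromℕ< x+1<n , subst (toℕ x <_) (sym (toℕ-fromℕ< x+1<n)) ≤-refl))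

adjacent⇔successor : ∀ {n : ℕ} (x y : Fin n) →
  (toℕ x < toℕ y × ¬ ∃ λ (w : Fin n) → toℕ x < toℕ w × toℕ w < toℕ y) ⇔ (toℕ y ≡ suc (toℕ x))
adjacent⇔successor {n} x y = mk⇔ successor adjacent
  where
  successor : (toℕ x < toℕ y × ¬ ∃ λ (w : Fin n) → toℕ x < toℕ w × toℕ w < toℕ y) → toℕ y ≡ suc (toℕ x)
  successor (x<y , ∄) with suc (toℕ x) ≟ toℕ y
  ... | yes x+1≡y = sym x+1≡y
  ... | no  x+1≢y = ⊥-elim (∄ (w , subst (toℕ x <_) (sym w≡x+1) ≤-refl
                                  , subst (_< toℕ y) (sym w≡x+1) x+1<y))
    where
    x+1<y = ≤∧≢⇒< x<y x+1≢y
    w = fromℕ< (<-trans x+1<y (toℕ<n y))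
    w≡x+1 = toℕ-fromℕ< (<-trans x+1<y (toℕ<n y))
  adjacent : toℕ y ≡ suc (toℕ x) → toℕ x < toℕ y × ¬ ∃ λ (w : Fin n) → toℕ x < toℕ w × toℕ w < toℕ y
  adjacent y≡x+1 = subst (toℕ x <_) (sym y≡x+1) ≤-refl
                 , λ (w , x<w , w<y) → <⇒≱ x<w (s≤s⁻¹ (subst (toℕ w <_) y≡x+1 w<y))

-- The counter

tick : ℕ → ℕ → ℕ
tick x zero    = suc x
tick x (suc k) = k

counter : ℕ → ℕ
counter zero    = zero
counter (suc x) = tick x (counter x)

counter-≤ : ∀ x → counter x ≤ x
counter-≤ zero = z≤n
counter-≤ (suc x) with counter x | counter-≤ x
... | zero  | _   = ≤-refl
... | suc k | k<x = m<n⇒m≤1+n k<x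

counter-countdown : ∀ {w} → counter w ≡ 0 → ∀ i j → suc i + j ≡ suc (suc w) → counter (w + suc i) ≡ j
counter-countdown {w} cw≡0 zero j i+j≡w+2 rewrite +-suc w 0 | +-identityʳ w | cw≡0 =
  sym (suc-injective i+j≡w+2)
counter-countdown {w} cw≡0 (suc i) j i+j≡w+2
  rewrite +-suc w (suc i) | counter-countdown cw≡0 i (suc j) (trans (cong suc (+-suc i j)) i+j≡w+2) =
  refl

counter-positiveAfterZero : ∀ {w i} → counter w ≡ 0 → i ≤ w → counter (w + suc i) ≢ 0
counter-positiveAfterZero {w} {i} cw≡0 i≤w
  with d , i+d≡w ← m≤n⇒∃[o]m+o≡n i≤w
  rewrite counter-countdown cw≡0 i (suc d) (cong suc (trans (+-suc i d) (cong suc i+d≡w))) = λ ()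

zeroOfCounter : ℕ → ℕ
zeroOfCounter zero    = zero
zeroOfCounter (suc k) = zeroOfCounter k + suc (suc (zeroOfCounter k))

counter-zeroOfCounter : ∀ k → counter (zeroOfCounter k) ≡ 0
counter-zeroOfCounter zero    = refl
counter-zeroOfCounter (suc k) =
  counter-countdown (counter-zeroOfCounter k) (suc (zeroOfCounter k)) 0 (+-identityʳ _)

zeroOfCounter-≥ : ∀ k → k ≤ zeroOfCounter k
zeroOfCounter-≥ zero    = z≤n
zeroOfCounter-≥ (suc k) =
  ≤-trans (s≤s (m≤n⇒m≤1+n (zeroOfCounter-≥ k))) (m≤n+m _ (zeroOfCounter k))

counter-sparseZeros : ∀ N p → 1 ≤ p → ∃ λ w → N ≤ w × counter w ≡ 0 × counter (w + p) ≢ 0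
counter-sparseZeros N (suc i) _ =
  w , ≤-trans (m≤m+n N (suc i)) N+p≤w , counter-zeroOfCounter (N + suc i)
    , counter-positiveAfterZero (counter-zeroOfCounter (N + suc i))
                                (≤-trans (m≤n+m i N) (≤-trans (+-monoʳ-≤ N (n≤1+n i)) N+p≤w))
  where
  w = zeroOfCounter (N + suc i)
  N+p≤w = zeroOfCounter-≥ (N + suc i)

-- Derived formulas and the counter sentence

infixr 4 _⇒'_ _∨'_ _⇔'_

∀'_ : ∀ {k} → Formula (suc k) → Formula k
∀' ψ = ¬' (∃' (¬' ψ))

_⇒'_ _∨'_ _⇔'_ : ∀ {k} → Formula k → Formula k → Formula k
ψ ⇒' χ = ¬' (ψ ∧' (¬' χ))
ψ ∨' χ = ¬' ((¬' ψ) ∧' (¬' χ))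
ψ ⇔' χ = (ψ ⇒' χ) ∧' (χ ⇒' ψ)

minF maxF emptyRowF : ∀ {k} → Fin k → Formula k
minF x      = ¬' (∃' (fz <' fs x))
maxF x      = ¬' (∃' (fs x <' fz))
emptyRowF x = ∀' (¬' R⟨ fs x , fz ⟩)

successorF : ∀ {k} → Fin k → Fin k → Formula k
successorF x y = (x <' y) ∧' (¬' (∃' ((fs x <' fz) ∧' (fz <' fs y))))

-- Row x+1, evaluated at y, for the row x given by R: either y + 1 lies in row x,
-- or row x is empty and y ≤ x.
nextRowF : ∀ {k} → Fin k → Fin k → Formula k
nextRowF x y = (∃' (successorF (fs y) fz ∧' R⟨ fs x , fz ⟩)) ∨' (emptyRowF x ∧' (¬' (x <' y)))

counterSentence : Sentence
counterSentence =
  (∀' (minF (# 0) ⇒' emptyRowF (# 0)))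
  ∧' ((∀' ∀' (successorF (# 1) (# 0) ⇒' ∀' (R⟨ # 1 , # 0 ⟩ ⇔' nextRowF (# 2) (# 0))))
  ∧' (∀' (maxF (# 0) ⇒' emptyRowF (# 0))))

counterRelation : ∀ {n} → Fin n → Fin n → Bool
counterRelation x y = toℕ y <ᵇ counter (toℕ x)

-- Models of the counter sentence

module Semantics {n : ℕ} (R : Fin n → Fin n → Bool) where

  EmptyRow : Fin n → Set
  EmptyRow x = ∀ z → ¬ T (R x z)

  NextRow : Fin n → Fin n → Set
  NextRow x y = (∃ λ y′ → toℕ y′ ≡ suc (toℕ y) × T (R x y′)) ⊎ (EmptyRow x × ¬ toℕ x < toℕ y)

  FirstRowEmpty RowRecurrence LastRowEmpty CounterAxioms IsCounterRelation : Set
  FirstRowEmpty     = ∀ x → toℕ x ≡ 0 → EmptyRow x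
  RowRecurrence     = ∀ x x′ → toℕ x′ ≡ suc (toℕ x) → ∀ y → T (R x′ y) ⇔ NextRow x y
  LastRowEmpty      = ∀ x → suc (toℕ x) ≡ n → EmptyRow x
  CounterAxioms     = FirstRowEmpty × RowRecurrence × LastRowEmpty
  IsCounterRelation = ∀ x y → T (R x y) ⇔ toℕ y < counter (toℕ x)

  module _ {k} (ρ : Fin k → Fin n) where

    sat-minF : ∀ x → Reflects (toℕ (ρ x) ≡ 0) (sat n R (minF x) ρ)
    sat-minF x = map-reflects (nothingBelow⇔zero (ρ x))
                   (¬-reflects (anyFin-reflects n λ w → <ᵇ-reflects-< _ _))

    sat-maxF : ∀ x → Reflects (suc (toℕ (ρ x)) ≡ n) (sat n R (maxF x) ρ)
    sat-maxF x = map-reflects (nothingAbove⇔last (ρ x))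
                   (¬-reflects (anyFin-reflects n λ w → <ᵇ-reflects-< _ _))

    sat-emptyRowF : ∀ x → Reflects (EmptyRow (ρ x)) (sat n R (emptyRowF x) ρ)
    sat-emptyRowF x = allFin-reflects n λ z → ¬-reflects (T-reflects (R (ρ x) z))

    sat-successorF : ∀ x y → Reflects (toℕ (ρ y) ≡ suc (toℕ (ρ x))) (sat n R (successorF x y) ρ)
    sat-successorF x y =
      map-reflects (adjacent⇔successor (ρ x) (ρ y))
        (<ᵇ-reflects-< _ _ ×-reflects
         ¬-reflects (anyFin-reflects n λ w → <ᵇ-reflects-< _ _ ×-reflects <ᵇ-reflects-< _ _))

  sat-nextRowF : ∀ {k} (ρ : Fin k → Fin n) x y →
                 Reflects (NextRow (ρ x) (ρ y)) (sat n R (nextRowF x y) ρ)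
  sat-nextRowF ρ x y =
    ∨-reflects (anyFin-reflects n λ y′ → sat-successorF (extend y′ ρ) (fs y) fz
                                          ×-reflects T-reflects (R (ρ x) y′))
               (sat-emptyRowF ρ x ×-reflects ¬-reflects (<ᵇ-reflects-< _ _))

  sat-counterSentence : Reflects CounterAxioms (R ⊨ counterSentence)
  sat-counterSentence =
    allFin-reflects n (λ x → ⇒-reflects (sat-minF (ρ₁ x) (# 0)) (sat-emptyRowF (ρ₁ x) (# 0)))
    ×-reflects
    allFin-reflects n (λ x → allFin-reflects n λ x′ →
      ⇒-reflects (sat-successorF (ρ₂ x x′) (# 1) (# 0))
                 (allFin-reflects n λ y →
                   ⇔-reflects (T-reflects (R x′ y)) (sat-nextRowF (extend y (ρ₂ x x′)) (# 2) (# 0))))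
    ×-reflects
    allFin-reflects n (λ x → ⇒-reflects (sat-maxF (ρ₁ x) (# 0)) (sat-emptyRowF (ρ₁ x) (# 0)))
    where
    ρ₁ : Fin n → Fin 1 → Fin n
    ρ₁ x = extend x noVars
    ρ₂ : Fin n → Fin n → Fin 2 → Fin n
    ρ₂ x x′ = extend x′ (ρ₁ x)

  nextRow⇔tick : ∀ {k} x → (∀ y → T (R x y) ⇔ toℕ y < k) → k ≤ n →
                 ∀ y → NextRow x y ⇔ toℕ y < tick (toℕ x) k
  nextRow⇔tick {zero} x row _ y =
    mk⇔ [ (λ (y′ , _ , r) → ⊥-elim (n≮0 (to (row y′) r))) , (λ (_ , x≮y) → s≤s (≮⇒≥ x≮y)) ]
        (λ y≤x → inj₂ ((λ z r → n≮0 (to (row z) r)) , (λ x<y → <⇒≱ x<y (s≤s⁻¹ y≤x))))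
  nextRow⇔tick {suc j} x row j<n y =
    mk⇔ [ (λ (y′ , y′≡y+1 , r) → s≤s⁻¹ (subst (_< suc j) y′≡y+1 (to (row y′) r)))
        , (λ (empty , _) → ⊥-elim (empty z₀ (from (row z₀) (subst (_< suc j) (sym z₀≡0) z<s)))) ]
        (λ y<j → inj₁ (fromℕ< (y+1<n y<j) , toℕ-fromℕ< (y+1<n y<j)
                      , from (row _) (subst (_< suc j) (sym (toℕ-fromℕ< (y+1<n y<j))) (s<s y<j))))
    where
    z₀ = fromℕ< (<-≤-trans z<s j<n)
    z₀≡0 = toℕ-fromℕ< (<-≤-trans z<s j<n)
    y+1<n : toℕ y < j → suc (toℕ y) < n
    y+1<n y<j = <-≤-trans (s<s y<j) j<n

  counter≤n : ∀ x → counter (toℕ x) ≤ n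
  counter≤n x = ≤-trans (counter-≤ (toℕ x)) (<⇒≤ (toℕ<n x))

  nextRow⇔counter : IsCounterRelation → ∀ x y → NextRow x y ⇔ toℕ y < counter (suc (toℕ x))
  nextRow⇔counter isCounter x = nextRow⇔tick x (isCounter x) (counter≤n x)

  rows-counter : FirstRowEmpty → RowRecurrence → IsCounterRelation
  rows-counter first recurrence x = rowsFrom (toℕ x) x refl
    where
    rowsFrom : ∀ a x → toℕ x ≡ a → ∀ y → T (R x y) ⇔ toℕ y < counter a
    rowsFrom zero    x x≡0   y = mk⇔ (⊥-elim ∘ first x x≡0 y) (λ ())
    rowsFrom (suc a) x x≡a+1 y =
      ⇔-trans (recurrence x₋ x (trans x≡a+1 (cong suc (sym x₋≡a))) y)
              (subst (λ b → NextRow x₋ y ⇔ toℕ y < tick b (counter a)) x₋≡a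
                     (nextRow⇔tick x₋ (rowsFrom a x₋ x₋≡a) (≤-trans (counter-≤ a) (<⇒≤ a<n)) y))
      where
      a<n = <-trans (n<1+n a) (subst (_< n) x≡a+1 (toℕ<n x))
      x₋ = fromℕ< a<n
      x₋≡a = toℕ-fromℕ< a<n

  isCounterRelation⇔≡counterRelation : IsCounterRelation ⇔ (∀ x y → R x y ≡ counterRelation x y)
  isCounterRelation⇔≡counterRelation =
    mk⇔ (λ isCounter x y → from (≡⇔T⇔ (<ᵇ-reflects-< _ _)) (isCounter x y))
        (λ ≡counter x y → to (≡⇔T⇔ (<ᵇ-reflects-< _ _)) (≡counter x y))

counterAxioms⇔ : ∀ {m} (R : Fin (suc m) → Fin (suc m) → Bool) → let open Semantics R in
                 CounterAxioms ⇔ (IsCounterRelation × counter m ≡ 0)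
counterAxioms⇔ {m} R = mk⇔ axioms⇒ axioms⇐
  where
  open Semantics R
  axioms⇒ : CounterAxioms → IsCounterRelation × counter m ≡ 0
  axioms⇒ (first , recurrence , last) = isCounter , n≤0⇒n≡0 (≮⇒≥ lastRowEmpty)
    where
    isCounter = rows-counter first recurrence
    lastRowEmpty : ¬ 0 < counter m
    lastRowEmpty 0<cm = last (fromℕ m) (cong suc (toℕ-fromℕ m)) fz
      (from (isCounter (fromℕ m) fz) (subst (λ a → 0 < counter a) (sym (toℕ-fromℕ m)) 0<cm))
  axioms⇐ : IsCounterRelation × counter m ≡ 0 → CounterAxioms
  axioms⇐ (isCounter , cm≡0) = first , recurrence , last
    where
    first : FirstRowEmpty
    first x x≡0 z r = n≮0 (subst (λ a → toℕ z < counter a) x≡0 (to (isCounter x z) r))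
    last : LastRowEmpty
    last x x+1≡n z r = n≮0 (subst (toℕ z <_) cm≡0
      (subst (λ a → toℕ z < counter a) (suc-injective x+1≡n) (to (isCounter x z) r)))
    recurrence : RowRecurrence
    recurrence x x′ x′≡x+1 y =
      ⇔-trans (isCounter x′ y)
              (⇔-sym (subst (λ a → NextRow x y ⇔ toℕ y < counter a) (sym x′≡x+1)
                            (nextRow⇔counter isCounter x y)))

S-counterZero : ∀ {m} → counter m ≡ 0 → S counterSentence (suc m) ≡ 1
S-counterZero {m} cm≡0 =
  count-pointwiseEqual (suc m) counterRelation λ R → let open Semantics R in
    map-reflects (⇔-trans (counterAxioms⇔ R)
                   (mk⇔ (to isCounterRelation⇔≡counterRelation ∘ proj₁)
                        (λ ≡counter → from isCounterRelation⇔≡counterRelation ≡counter , cm≡0)))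
                 sat-counterSentence

S-counterNonzero : ∀ {m} → counter m ≢ 0 → S counterSentence (suc m) ≡ 0
S-counterNonzero {m} cm≢0 = count-none (allRelations (suc m)) λ R →
  reflects-false (Semantics.sat-counterSentence R) (cm≢0 ∘ proj₂ ∘ to (counterAxioms⇔ R))

-- Failure of periodicity

¬ultPeriodicMod2 : ∀ {s : ℕ → ℕ} → (∀ N p → 1 ≤ p → ∃ λ n → N ≤ n × s n ≡ 1 × s (n + p) ≡ 0) →
                   ¬ UltPeriodicMod s 2
¬ultPeriodicMod2 gaps (N , p , 1≤p , periodic) with gaps N p 1≤p
... | n , N≤n , sn≡1 , sn+p≡0
    with () ← subst₂ (λ u v → u % 2 ≡ v % 2) sn+p≡0 sn≡1 (periodic n N≤n)

proposition12 : Σ Sentence λ φ → ¬ MCFinite (S φ)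
proposition12 = counterSentence , λ mcFinite → ¬ultPeriodicMod2 S-gaps (mcFinite 2)
  where
  S-gaps : ∀ N p → 1 ≤ p →
           ∃ λ n → N ≤ n × S counterSentence n ≡ 1 × S counterSentence (n + p) ≡ 0
  S-gaps N p 1≤p with w , N≤w , cw≡0 , cw+p≢0 ← counter-sparseZeros N p 1≤p =
    suc w , m≤n⇒m≤1+n N≤w , S-counterZero {w} cw≡0 , S-counterNonzero {w + p} cw+p≢0
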